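{- For any closed term $M$, any $n\in\mathbb N$ and any $X,Y\in T\mathcal V_0$: if $M\Downarrow_n X$ and $M\Downarrow_n Y$ then $X=Y$.
   Context: $\Sigma$ is a signature (operation symbols with finite arities). $T$ is a monad on sets (unit $\eta$, bind $\gg\!=$) such that each $TX$ has a least element $\bot$ in an $\omega$CPPO structure and each $\sigma\in\Sigma$ of arity $k$ is interpreted as a map $\sigma^T:(TX)^k\to TX$. Terms and values: $M,N ::= \mathsf{return}\,V\mid VW\mid M\ \mathsf{to}\ x.N\mid\sigma(M_1,\dots,M_k)$, $V,W::=x\mid\lambda x.M$ ($x$ bound in $N$ in $M\ \mathsf{to}\ x.N$), up to $\alpha$-equivalence; $\mathcal V_0$ is the set of closed values and $M[V/x]$ is capture-avoiding substitution. The judgments $M\Downarrow_n X$ (closed $M$, $X\in T\mathcal V_0$, $n\in\mathbb N$) are the least relation closed under: $M\Downarrow_0\bot$ for every $M$; $\mathsf{return}\,V\Downarrow_{n+1}\eta(V)$; if $M[V/x]\Downarrow_n X$ then $(\lambda x.M)V\Downarrow_{n+1}X$; if $M\Downarrow_n X$ and $N[V/x]\Downarrow_n Y_V$ for every closed value $V$, then $(M\ \mathsf{to}\ x.N)\Downarrow_{n+1}X\gg\!=(V\mapsto Y_V)$; if $M_i\Downarrow_n X_i$ for $i=1..k$ then $\sigma(M_1,\dots,M_k)\Downarrow_{n+1}\sigma^T(X_1,\dots,X_k)$. -}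

module Defs where

open import Data.Nat using (ℕ; zero; suc)
open import Data.Fin using (Fin; zero; suc)
open import Data.Vec using (Vec; []; _∷_; lookup)
open import Relation.Binary.PropositionalEquality using (_≡_)

record Signature : Set₁ where
  field
    Op    : Set
    arity : Op → ℕ
open Signature public

record ωCPPO (A : Set) : Set₁ where
  field
    _⊑_       : A → A → Set
    ⊑-refl    : ∀ {x} → x ⊑ x
    ⊑-trans   : ∀ {x y z} → x ⊑ y → y ⊑ z → x ⊑ z
    ⊑-antisym : ∀ {x y} → x ⊑ y → y ⊑ x → x ≡ y
    bot       : A
    bot-least : ∀ {x} → bot ⊑ x
    lub       : (c : ℕ → A) → (∀ i → c i ⊑ c (suc i)) → A
    lub-upper : ∀ c p i → c i ⊑ lub c p
    lub-least : ∀ c p {x} → (∀ i → c i ⊑ x) → lub c p ⊑ x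

record Model (S : Signature) : Set₁ where
  field
    T      : Set → Set
    η      : ∀ {X} → X → T X
    _>>=_  : ∀ {X Y} → T X → (X → T Y) → T Y
    left-id  : ∀ {X Y} (x : X) (f : X → T Y) → (η x >>= f) ≡ f x
    right-id : ∀ {X} (m : T X) → (m >>= η) ≡ m
    assoc    : ∀ {X Y Z} (m : T X) (f : X → T Y) (g : Y → T Z) →
               ((m >>= f) >>= g) ≡ (m >>= λ x → f x >>= g)
    -- functions are extensional in set theory; bind respects pointwise equality
    >>=-cong : ∀ {X Y} (m : T X) (f g : X → T Y) → (∀ x → f x ≡ g x) →
               (m >>= f) ≡ (m >>= g)
    cppo   : ∀ X → ωCPPO (T X)
    opT    : ∀ {X} (σ : Op S) → Vec (T X) (arity S σ) → T X

  ⊥T : ∀ {X} → T X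
  ⊥T {X} = ωCPPO.bot (cppo X)
open Model public

-- Well-scoped de Bruijn syntax (terms up to α-equivalence).
mutual
  data Val (S : Signature) (n : ℕ) : Set where
    var : Fin n → Val S n
    lam : Term S (suc n) → Val S n

  data Term (S : Signature) (n : ℕ) : Set where
    ret : Val S n → Term S n
    app : Val S n → Val S n → Term S n
    _to_ : Term S n → Term S (suc n) → Term S n
    op  : (σ : Op S) → Vec (Term S n) (arity S σ) → Term S n

module _ {S : Signature} where
  Ren : ℕ → ℕ → Set
  Ren m n = Fin m → Fin n

  liftR : ∀ {m n} → Ren m n → Ren (suc m) (suc n)
  liftR ρ zero = zero
  liftR ρ (suc i) = suc (ρ i)

  mutual
    renV : ∀ {m n} → Ren m n → Val S m → Val S n
    renV ρ (var i) = var (ρ i)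
    renV ρ (lam M) = lam (renT (liftR ρ) M)

    renT : ∀ {m n} → Ren m n → Term S m → Term S n
    renT ρ (ret V) = ret (renV ρ V)
    renT ρ (app V W) = app (renV ρ V) (renV ρ W)
    renT ρ (M to N) = renT ρ M to renT (liftR ρ) N
    renT ρ (op σ Ms) = op σ (renTs ρ Ms)

    renTs : ∀ {m n k} → Ren m n → Vec (Term S m) k → Vec (Term S n) k
    renTs ρ [] = []
    renTs ρ (M ∷ Ms) = renT ρ M ∷ renTs ρ Ms

  Sub : ℕ → ℕ → Set
  Sub m n = Fin m → Val S n

  liftS : ∀ {m n} → Sub m n → Sub (suc m) (suc n)
  liftS s zero = var zero
  liftS s (suc i) = renV suc (s i)

  mutual
    subV : ∀ {m n} → Sub m n → Val S m → Val S n
    subV s (var i) = s i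
    subV s (lam M) = lam (subT (liftS s) M)

    subT : ∀ {m n} → Sub m n → Term S m → Term S n
    subT s (ret V) = ret (subV s V)
    subT s (app V W) = app (subV s V) (subV s W)
    subT s (M to N) = subT s M to subT (liftS s) N
    subT s (op σ Ms) = op σ (subTs s Ms)

    subTs : ∀ {m n k} → Sub m n → Vec (Term S m) k → Vec (Term S n) k
    subTs s [] = []
    subTs s (M ∷ Ms) = subT s M ∷ subTs s Ms

  _[_/0] : Term S 1 → Val S 0 → Term S 0
  M [ V /0] = subT (λ { zero → V }) M

data Eval {S : Signature} (𝕋 : Model S) :
     Term S 0 → ℕ → T 𝕋 (Val S 0) → Set where
  e-bot : ∀ {M} → Eval 𝕋 M 0 (⊥T 𝕋)
  e-ret : ∀ {V n} → Eval 𝕋 (ret V) (suc n) (η 𝕋 V)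
  e-app : ∀ {M V n X} → Eval 𝕋 (M [ V /0]) n X →
          Eval 𝕋 (app (lam M) V) (suc n) X
  e-to  : ∀ {M N n X} {Y : Val S 0 → T 𝕋 (Val S 0)} →
          Eval 𝕋 M n X → (∀ V → Eval 𝕋 (N [ V /0]) n (Y V)) →
          Eval 𝕋 (M to N) (suc n) (_>>=_ 𝕋 X Y)
  e-op  : ∀ {σ Ms n Xs} →
          (∀ i → Eval 𝕋 (lookup Ms i) n (lookup Xs i)) →
          Eval 𝕋 (op σ Ms) (suc n) (opT 𝕋 σ Xs)

module Submission where

open import Defs
open import Data.Nat using (ℕ)
open import Data.Vec.Relation.Binary.Pointwise.Extensional using (ext; Pointwise-≡⇒≡)
open import Relation.Binary.PropositionalEquality using (_≡_; refl; cong)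

Eval-deterministic : ∀ {S} {𝕋 : Model S} {M : Term S 0} {n : ℕ} {X Y : T 𝕋 (Val S 0)} →
                     Eval 𝕋 M n X → Eval 𝕋 M n Y → X ≡ Y
Eval-deterministic e-bot e-bot = refl
Eval-deterministic e-ret e-ret = refl
Eval-deterministic (e-app M⇓X) (e-app M⇓Y) = Eval-deterministic M⇓X M⇓Y
Eval-deterministic {𝕋 = 𝕋} (e-to {Y = K} M⇓X N⇓K) (e-to {Y = K′} M⇓X′ N⇓K′)
  with refl ← Eval-deterministic M⇓X M⇓X′ =
  -- the continuations agree only pointwise, which bind respects
  >>=-cong 𝕋 _ K K′ (λ V → Eval-deterministic (N⇓K V) (N⇓K′ V))
Eval-deterministic {𝕋 = 𝕋} (e-op {σ = σ} Ms⇓Xs) (e-op Ms⇓Ys) =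
  cong (opT 𝕋 σ) (Pointwise-≡⇒≡ (ext λ i → Eval-deterministic (Ms⇓Xs i) (Ms⇓Ys i)))

mainTheorem10 : (S : Signature) (𝕋 : Model S) (M : Term S 0) (n : ℕ)
    (X Y : T 𝕋 (Val S 0)) → Eval 𝕋 M n X → Eval 𝕋 M n Y → X ≡ Y
mainTheorem10 S 𝕋 M n X Y = Eval-deterministic
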